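{- Let $t\geq 0$ be an integer and $s$ an odd integer with $-1\leq s\leq 2t+1$. Then for every integer $n\ge 1$ and every $q\in\mathbb{C}$ with $|q|<1$, $$\sum_{i=-n-t}^{n}\frac{(-1)^{i}q^{(i^2+si)/2}}{(q;q)_{n-i}(q;q)_{n+t+i}}=0.$$
   Context: For integers $m\ge0$, $(q;q)_m=\prod_{k=1}^{m}(1-q^k)$ (with $(q;q)_0=1$). Since $s$ is odd, $(i^2+si)/2$ is an integer. -}

module Defs where

open import Level using (Level)
open import Data.Nat as ℕ using (ℕ; zero; suc)
open import Data.Integer as ℤ using (ℤ; +_; -[1+_])
open import Data.Integer.DivMod using (_/_)
open import Algebra.Bundles using (CommutativeRing)

module QSeries {c ℓ : Level} (R : CommutativeRing c ℓ) where
  open CommutativeRing R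

  pow : Carrier → ℕ → Carrier
  pow x zero    = 1#
  pow x (suc m) = x * pow x m

  zpow : Carrier → Carrier → ℤ → Carrier
  zpow x xinv (+ m)      = pow x m
  zpow x xinv -[1+ m ]   = pow xinv (suc m)

  qpoch : Carrier → ℕ → Carrier
  qpoch x zero    = 1#
  qpoch x (suc m) = qpoch x m * (1# + - pow x (suc m))

  signZ : ℤ → Carrier
  signZ i = pow (- 1#) ℤ.∣ i ∣

  sumFrom : ℤ → ℕ → (ℤ → Carrier) → Carrier
  sumFrom a zero    f = 0#
  sumFrom a (suc k) f = f a + sumFrom (ℤ.suc a) k f

-- the exponent (i² + s i)/2 (exact division, i² + s i is even for odd s)
halfExp : ℤ → ℤ → ℤ
halfExp s i = (i ℤ.* i ℤ.+ s ℤ.* i) / (+ 2)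

-- Write s = 2k − 1 and M = n + t = k + m. Substituting i = b − M, the exponent (i² + s i)/2
-- becomes C(b,2) − m b plus a constant, and the denominators become (q;q)_a (q;q)_b with
-- a + b = N = n + M. Up to a constant factor the sum is therefore
--   Σ_{a+b=N} (−1)^b q^{C(b,2)} z^b / ((q;q)_a (q;q)_b),   z = q^{−m},
-- which by the q-binomial theorem equals (z;q)_N / (q;q)_N. Since m < N, the product
-- (z;q)_N contains the factor 1 − z q^m = 0.

module Submission where

open import Defs
open import Data.Nat as ℕ using (ℕ; zero; suc)
open import Data.Nat.Combinatorics using (_C_; nCk+nC[k+1]≡[n+1]C[k+1]; nC1≡n)
import Data.Nat.Properties as ℕP
import Data.Nat.Tactic.RingSolver as ℕ-Solver
open import Data.Integer as ℤ using (ℤ; +_; -[1+_]; _⊖_)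
open import Data.Integer.DivMod using (_/_)
import Data.Integer.Properties as ℤP
open import Data.Product using (∃-syntax; _×_; _,_)
open import Data.List using ([]; _∷_)
open import Algebra.Bundles using (CommutativeRing)
import Relation.Binary.PropositionalEquality as ≡
open ≡ using (_≡_)

module Arithmetic where
  open ≡
  open import Data.Empty using (⊥-elim)
  import Data.Nat.DivMod as ℕD
  open import Data.Integer.Tactic.RingSolver using (solve; solve-∀)

  [1+n]C2≡n+nC2 : ∀ n → suc n C 2 ≡ n ℕ.+ n C 2
  [1+n]C2≡n+nC2 n = trans (sym (nCk+nC[k+1]≡[n+1]C[k+1] n 1)) (cong (ℕ._+ n C 2) (nC1≡n n))

  nC2+nC2+n≡n*n : ∀ n → n C 2 ℕ.+ n C 2 ℕ.+ n ≡ n ℕ.* n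
  nC2+nC2+n≡n*n zero = refl
  nC2+nC2+n≡n*n (suc n) = begin
    suc n C 2 ℕ.+ suc n C 2 ℕ.+ suc n         ≡⟨ cong (λ x → x ℕ.+ x ℕ.+ suc n) ([1+n]C2≡n+nC2 n) ⟩
    (n ℕ.+ n C 2) ℕ.+ (n ℕ.+ n C 2) ℕ.+ suc n ≡⟨ square-step n (n C 2) (nC2+nC2+n≡n*n n) ⟩
    suc n ℕ.* suc n                           ∎
    where
    open ≡-Reasoning
    square-step : ∀ n c → c ℕ.+ c ℕ.+ n ≡ n ℕ.* n →
                  (n ℕ.+ c) ℕ.+ (n ℕ.+ c) ℕ.+ suc n ≡ suc n ℕ.* suc n
    square-step n c h = begin
      (n ℕ.+ c) ℕ.+ (n ℕ.+ c) ℕ.+ suc n   ≡⟨ ℕ-Solver.solve (n ∷ c ∷ []) ⟩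
      (c ℕ.+ c ℕ.+ n) ℕ.+ (n ℕ.+ n ℕ.+ 1) ≡⟨ cong (ℕ._+ (n ℕ.+ n ℕ.+ 1)) h ⟩
      n ℕ.* n ℕ.+ (n ℕ.+ n ℕ.+ 1)         ≡⟨ ℕ-Solver.solve (n ∷ []) ⟩
      suc n ℕ.* suc n                     ∎

  i*n/n≡i : ∀ i n .{{_ : ℕ.NonZero n}} → i ℤ.* + n / + n ≡ i
  i*n/n≡i (+ i) (suc n) = begin
    + i ℤ.* + suc n / + suc n    ≡⟨ ℤP.*-identityˡ _ ⟩
    + i ℤ.* + suc n ℤ./ℕ suc n   ≡⟨ cong (ℤ._/ℕ suc n) (sym (ℤP.pos-* i (suc n))) ⟩
    + (i ℕ.* suc n ℕ./ suc n)    ≡⟨ cong +_ (ℕD.m*n/n≡m i (suc n)) ⟩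
    + i                          ∎
    where open ≡-Reasoning
  i*n/n≡i -[1+ i ] (suc n) = trans (ℤP.*-identityˡ _) neg
    where
    neg : -[1+ i ] ℤ.* + suc n ℤ./ℕ suc n ≡ -[1+ i ]
    neg rewrite ℕD.m*n%n≡0 (suc i) (suc n) {{_}} | ℕD.m*n/n≡m (suc i) (suc n) {{_}} = refl

  [nC2]+[nC2]+n≡n*n : ∀ n → + (n C 2) ℤ.+ + (n C 2) ℤ.+ + n ≡ + n ℤ.* + n
  [nC2]+[nC2]+n≡n*n n = begin
    + (n C 2) ℤ.+ + (n C 2) ℤ.+ + n ≡⟨ cong (ℤ._+ + n) (ℤP.pos-+ (n C 2) (n C 2)) ⟨
    + (n C 2 ℕ.+ n C 2) ℤ.+ + n     ≡⟨ ℤP.pos-+ (n C 2 ℕ.+ n C 2) n ⟨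
    + (n C 2 ℕ.+ n C 2 ℕ.+ n)       ≡⟨ cong +_ (nC2+nC2+n≡n*n n) ⟩
    + (n ℕ.* n)                     ≡⟨ ℤP.pos-* n n ⟩
    + n ℤ.* + n                     ∎
    where open ≡-Reasoning

  halfExp-odd-shift-numerator : ∀ B K L cB cL → cB ℤ.+ cB ℤ.+ B ≡ B ℤ.* B →
    cL ℤ.+ cL ℤ.+ (+ 1 ℤ.+ (K ℤ.+ L)) ≡ (+ 1 ℤ.+ (K ℤ.+ L)) ℤ.* (+ 1 ℤ.+ (K ℤ.+ L)) →
    (ℤ.- (K ℤ.+ L) ℤ.+ B) ℤ.* (ℤ.- (K ℤ.+ L) ℤ.+ B) ℤ.+ (+ 2 ℤ.* K ℤ.- + 1) ℤ.* (ℤ.- (K ℤ.+ L) ℤ.+ B)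
      ≡ (cB ℤ.+ cL ℤ.- (L ℤ.* B ℤ.+ K ℤ.* (K ℤ.+ L))) ℤ.* + 2
  halfExp-odd-shift-numerator B K L cB cL hB hL = begin
    (ℤ.- (K ℤ.+ L) ℤ.+ B) ℤ.* (ℤ.- (K ℤ.+ L) ℤ.+ B) ℤ.+ (+ 2 ℤ.* K ℤ.- + 1) ℤ.* (ℤ.- (K ℤ.+ L) ℤ.+ B)
      ≡⟨ solve (B ∷ K ∷ L ∷ []) ⟩
    (B ℤ.* B ℤ.- B) ℤ.+ ((+ 1 ℤ.+ (K ℤ.+ L)) ℤ.* (+ 1 ℤ.+ (K ℤ.+ L)) ℤ.- (+ 1 ℤ.+ (K ℤ.+ L)))
      ℤ.- (L ℤ.* B ℤ.+ K ℤ.* (K ℤ.+ L)) ℤ.* + 2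
      ≡⟨ cong₂ (λ x y → (x ℤ.- B) ℤ.+ (y ℤ.- (+ 1 ℤ.+ (K ℤ.+ L))) ℤ.- (L ℤ.* B ℤ.+ K ℤ.* (K ℤ.+ L)) ℤ.* + 2)
               (sym hB) (sym hL) ⟩
    (cB ℤ.+ cB ℤ.+ B ℤ.- B) ℤ.+ (cL ℤ.+ cL ℤ.+ (+ 1 ℤ.+ (K ℤ.+ L)) ℤ.- (+ 1 ℤ.+ (K ℤ.+ L)))
      ℤ.- (L ℤ.* B ℤ.+ K ℤ.* (K ℤ.+ L)) ℤ.* + 2
      ≡⟨ solve (B ∷ K ∷ L ∷ cB ∷ cL ∷ []) ⟩
    (cB ℤ.+ cL ℤ.- (L ℤ.* B ℤ.+ K ℤ.* (K ℤ.+ L))) ℤ.* + 2 ∎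
    where open ≡-Reasoning

  halfExp-odd-shift : ∀ k m b →
    halfExp (+ 2 ℤ.* + k ℤ.- + 1) (ℤ.- + (k ℕ.+ m) ℤ.+ + b)
      ≡ (b C 2 ℕ.+ suc (k ℕ.+ m) C 2) ⊖ (m ℕ.* b ℕ.+ k ℕ.* (k ℕ.+ m))
  halfExp-odd-shift k m b = begin
    halfExp s (ℤ.- + (k ℕ.+ m) ℤ.+ B)
      ≡⟨ cong (λ x → halfExp s (ℤ.- x ℤ.+ B)) (ℤP.pos-+ k m) ⟩
    halfExp s (ℤ.- (K ℤ.+ L) ℤ.+ B)
      ≡⟨ cong (_/ + 2) (halfExp-odd-shift-numerator B K L cB cL ([nC2]+[nC2]+n≡n*n b) hL) ⟩
    (cB ℤ.+ cL ℤ.- (L ℤ.* B ℤ.+ K ℤ.* (K ℤ.+ L))) ℤ.* + 2 / + 2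
      ≡⟨ i*n/n≡i _ 2 ⟩
    cB ℤ.+ cL ℤ.- (L ℤ.* B ℤ.+ K ℤ.* (K ℤ.+ L))
      ≡⟨ cong₂ ℤ._-_ (ℤP.pos-+ (b C 2) (suc (k ℕ.+ m) C 2)) Q≡ ⟨
    + (b C 2 ℕ.+ suc (k ℕ.+ m) C 2) ℤ.- + (m ℕ.* b ℕ.+ k ℕ.* (k ℕ.+ m))
      ≡⟨ ℤP.[+m]-[+n]≡m⊖n (b C 2 ℕ.+ suc (k ℕ.+ m) C 2) (m ℕ.* b ℕ.+ k ℕ.* (k ℕ.+ m)) ⟩
    (b C 2 ℕ.+ suc (k ℕ.+ m) C 2) ⊖ (m ℕ.* b ℕ.+ k ℕ.* (k ℕ.+ m)) ∎
    where
    open ≡-Reasoning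
    s = + 2 ℤ.* + k ℤ.- + 1
    B = + b
    K = + k
    L = + m
    cB = + (b C 2)
    cL = + (suc (k ℕ.+ m) C 2)
    1+K+L : + suc (k ℕ.+ m) ≡ + 1 ℤ.+ (K ℤ.+ L)
    1+K+L = trans (ℤP.pos-+ 1 (k ℕ.+ m)) (cong (ℤ._+_ (+ 1)) (ℤP.pos-+ k m))
    hL : cL ℤ.+ cL ℤ.+ (+ 1 ℤ.+ (K ℤ.+ L)) ≡ (+ 1 ℤ.+ (K ℤ.+ L)) ℤ.* (+ 1 ℤ.+ (K ℤ.+ L))
    hL = subst (λ x → cL ℤ.+ cL ℤ.+ x ≡ x ℤ.* x) 1+K+L ([nC2]+[nC2]+n≡n*n (suc (k ℕ.+ m)))
    Q≡ : + (m ℕ.* b ℕ.+ k ℕ.* (k ℕ.+ m)) ≡ L ℤ.* B ℤ.+ K ℤ.* (K ℤ.+ L)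
    Q≡ = trans (ℤP.pos-+ (m ℕ.* b) _)
           (cong₂ ℤ._+_ (ℤP.pos-* m b) (trans (ℤP.pos-* k (k ℕ.+ m)) (cong (K ℤ.*_) (ℤP.pos-+ k m))))

  odd≥-1⇒2j-1 : ∀ t s k → s ≡ + 1 ℤ.+ + 2 ℤ.* k → ℤ.- (+ 1) ℤ.≤ s → s ℤ.≤ + (2 ℕ.* t ℕ.+ 1) →
    ∃[ j ] j ℕ.≤ suc t × s ≡ + 2 ℤ.* + j ℤ.- + 1
  odd≥-1⇒2j-1 t s (+ j) refl _ s≤ = suc j , ℕ.s≤s (ℕP.*-cancelˡ-≤ 2 (ℕ.s≤s⁻¹ 1+2j≤1+2t)) , shift (+ j)
    where
    1+2j≡ : + 1 ℤ.+ + 2 ℤ.* + j ≡ + (1 ℕ.+ 2 ℕ.* j)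
    1+2j≡ = trans (cong (ℤ._+_ (+ 1)) (sym (ℤP.pos-* 2 j))) (sym (ℤP.pos-+ 1 (2 ℕ.* j)))
    1+2j≤1+2t : 1 ℕ.+ 2 ℕ.* j ℕ.≤ 1 ℕ.+ 2 ℕ.* t
    1+2j≤1+2t = ℤP.drop‿+≤+ (subst₂ ℤ._≤_ 1+2j≡ (cong +_ (ℕP.+-comm (2 ℕ.* t) 1)) s≤)
    shift : ∀ J → + 1 ℤ.+ + 2 ℤ.* J ≡ + 2 ℤ.* (+ 1 ℤ.+ J) ℤ.- + 1
    shift = solve-∀
  odd≥-1⇒2j-1 t s -[1+ zero ] refl _ _ = 0 , ℕ.z≤n , refl
  odd≥-1⇒2j-1 t s -[1+ suc j ] refl (ℤ.-≤- 2j+3≤0) _ =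
    ⊥-elim (ℕP.<⇒≱ ℕ.z<s (ℕP.≤-trans (ℕP.m≤n+m (1 ℕ.* suc (suc j)) j) 2j+3≤0))

  ∣n-[-M+b]∣≡a : ∀ n M a b → a ℕ.+ b ≡ n ℕ.+ M → ℤ.∣ + n ℤ.- (ℤ.- + M ℤ.+ + b) ∣ ≡ a
  ∣n-[-M+b]∣≡a n M a b a+b≡n+M = cong ℤ.∣_∣ (begin
    + n ℤ.- (ℤ.- + M ℤ.+ + b) ≡⟨ reassoc (+ n) (+ M) (+ b) ⟩
    + n ℤ.+ + M ℤ.- + b       ≡⟨ cong (ℤ._- + b) (ℤP.pos-+ n M) ⟨
    + (n ℕ.+ M) ℤ.- + b       ≡⟨ cong (λ x → + x ℤ.- + b) a+b≡n+M ⟨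
    + (a ℕ.+ b) ℤ.- + b       ≡⟨ cong (ℤ._- + b) (ℤP.pos-+ a b) ⟩
    + a ℤ.+ + b ℤ.- + b       ≡⟨ cancel (+ a) (+ b) ⟩
    + a                       ∎)
    where
    open ≡-Reasoning
    reassoc : ∀ N M B → N ℤ.- (ℤ.- M ℤ.+ B) ≡ N ℤ.+ M ℤ.- B
    reassoc = solve-∀
    cancel : ∀ A B → A ℤ.+ B ℤ.- B ≡ A
    cancel = solve-∀

  ∣M+[-M+b]∣≡b : ∀ M b → ℤ.∣ + M ℤ.+ (ℤ.- + M ℤ.+ + b) ∣ ≡ b
  ∣M+[-M+b]∣≡b M b = cong ℤ.∣_∣ (cancel (+ M) (+ b))
    where
    cancel : ∀ M B → M ℤ.+ (ℤ.- M ℤ.+ B) ≡ B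
    cancel = solve-∀

  [1+i]+j≡i+[1+j] : ∀ i j → (+ 1 ℤ.+ i) ℤ.+ j ≡ i ℤ.+ (+ 1 ℤ.+ j)
  [1+i]+j≡i+[1+j] = solve-∀

open Arithmetic

module QSeriesProperties {c ℓ} (R : CommutativeRing c ℓ) where
  open CommutativeRing R
  open QSeries R
  open import Algebra.Properties.CommutativeSemiring.Exp commutativeSemiring
    using (_^_; ^-congˡ; ^-homo-*; ^-assocʳ; ^-distrib-*)
  open import Algebra.Properties.Ring ring using (-1*x≈-x; -‿involutive; -‿distribʳ-*; -‿distribˡ-*)
  open import Algebra.Properties.CommutativeSemigroup +-commutativeSemigroup
    using () renaming (interchange to +-interchange)
  open import Algebra.Properties.CommutativeSemigroup *-commutativeSemigroup
    using (x∙yz≈y∙xz) renaming (interchange to *-interchange)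
  open import Relation.Binary.Reasoning.Setoid setoid
  open import Algebra.Solver.Ring.NaturalCoefficients.Default commutativeSemiring

  pow≡^ : ∀ x m → pow x m ≡ x ^ m
  pow≡^ x zero    = ≡.refl
  pow≡^ x (suc m) = ≡.cong (x *_) (pow≡^ x m)

  pow-homo-+ : ∀ x m n → pow x (m ℕ.+ n) ≈ pow x m * pow x n
  pow-homo-+ x m n rewrite pow≡^ x (m ℕ.+ n) | pow≡^ x m | pow≡^ x n = ^-homo-* x m n

  pow-distrib-* : ∀ x y n → pow (x * y) n ≈ pow x n * pow y n
  pow-distrib-* x y n rewrite pow≡^ (x * y) n | pow≡^ x n | pow≡^ y n = ^-distrib-* x y n

  pow-assocʳ : ∀ x m n → pow (pow x m) n ≈ pow x (m ℕ.* n)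
  pow-assocʳ x m n rewrite pow≡^ x m | pow≡^ (x ^ m) n | pow≡^ x (m ℕ.* n) = ^-assocʳ x m n

  pow-congˡ : ∀ {x y} n → x ≈ y → pow x n ≈ pow y n
  pow-congˡ {x} {y} n x≈y rewrite pow≡^ x n | pow≡^ y n = ^-congˡ n x≈y

  pow-1# : ∀ n → pow 1# n ≈ 1#
  pow-1# zero    = refl
  pow-1# (suc n) = trans (*-identityˡ _) (pow-1# n)

  pow-inverse : ∀ {x y} → x * y ≈ 1# → ∀ n → pow x n * pow y n ≈ 1#
  pow-inverse {x} {y} xy≈1 n = begin
    pow x n * pow y n ≈⟨ pow-distrib-* x y n ⟨
    pow (x * y) n     ≈⟨ pow-congˡ n xy≈1 ⟩
    pow 1# n          ≈⟨ pow-1# n ⟩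
    1#                ∎

  zpow-⊖ : ∀ {x y} → x * y ≈ 1# → ∀ p m → zpow x y (p ⊖ m) ≈ pow x p * pow y m
  zpow-⊖ xy≈1 p       zero    = sym (*-identityʳ _)
  zpow-⊖ xy≈1 zero    (suc m) = sym (*-identityˡ _)
  zpow-⊖ {x} {y} xy≈1 (suc p) (suc m) rewrite ℤP.[1+m]⊖[1+n]≡m⊖n p m = begin
    zpow x y (p ⊖ m)                  ≈⟨ zpow-⊖ xy≈1 p m ⟩
    pow x p * pow y m                 ≈⟨ *-identityˡ _ ⟨
    1# * (pow x p * pow y m)          ≈⟨ *-congʳ xy≈1 ⟨
    (x * y) * (pow x p * pow y m)     ≈⟨ *-interchange x y (pow x p) (pow y m) ⟩
    (x * pow x p) * (y * pow y m)     ∎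

  signZ-⊖ : ∀ p m → signZ (p ⊖ m) ≈ pow (- 1#) p * pow (- 1#) m
  signZ-⊖ p m = trans (reflexive (signZ≡zpow (p ⊖ m))) (zpow-⊖ -1*-1≈1 p m)
    where
    signZ≡zpow : ∀ i → signZ i ≡ zpow (- 1#) (- 1#) i
    signZ≡zpow (+ _)    = ≡.refl
    signZ≡zpow -[1+ _ ] = ≡.refl
    -1*-1≈1 : - 1# * - 1# ≈ 1#
    -1*-1≈1 = trans (-1*x≈-x (- 1#)) (-‿involutive 1#)

  antidiagonalSum : ℕ → (ℕ → ℕ → Carrier) → Carrier
  antidiagonalSum zero    g = g 0 0
  antidiagonalSum (suc N) g = g (suc N) 0 + antidiagonalSum N (λ a b → g a (suc b))

  antidiagonalSum-cong : ∀ N {f g} → (∀ a b → a ℕ.+ b ≡ N → f a b ≈ g a b) →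
                         antidiagonalSum N f ≈ antidiagonalSum N g
  antidiagonalSum-cong zero    f≈g = f≈g 0 0 ≡.refl
  antidiagonalSum-cong (suc N) f≈g = +-cong (f≈g (suc N) 0 (ℕP.+-identityʳ (suc N)))
    (antidiagonalSum-cong N (λ a b a+b≡N → f≈g a (suc b) (≡.trans (ℕP.+-suc a b) (≡.cong suc a+b≡N))))

  antidiagonalSum-+ : ∀ N f g →
    antidiagonalSum N (λ a b → f a b + g a b) ≈ antidiagonalSum N f + antidiagonalSum N g
  antidiagonalSum-+ zero    f g = refl
  antidiagonalSum-+ (suc N) f g = trans (+-congˡ (antidiagonalSum-+ N _ _)) (+-interchange _ _ _ _)

  *-distribˡ-antidiagonalSum : ∀ N x f → x * antidiagonalSum N f ≈ antidiagonalSum N (λ a b → x * f a b)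
  *-distribˡ-antidiagonalSum zero    x f = refl
  *-distribˡ-antidiagonalSum (suc N) x f = trans (distribˡ x _ _) (+-congˡ (*-distribˡ-antidiagonalSum N x _))

  shiftˡ shiftʳ : (ℕ → ℕ → Carrier) → ℕ → ℕ → Carrier
  shiftˡ f zero    b       = 0#
  shiftˡ f (suc a) b       = f a b
  shiftʳ f a       zero    = 0#
  shiftʳ f a       (suc b) = f a b

  antidiagonalSum-shiftˡ : ∀ N f → antidiagonalSum (suc N) (shiftˡ f) ≈ antidiagonalSum N f
  antidiagonalSum-shiftˡ zero    f = +-identityʳ (f 0 0)
  antidiagonalSum-shiftˡ (suc N) f = +-congˡ (begin
    antidiagonalSum (suc N) (λ a b → shiftˡ f a (suc b)) ≈⟨ antidiagonalSum-cong (suc N) shift-suc ⟩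
    antidiagonalSum (suc N) (shiftˡ (λ a b → f a (suc b))) ≈⟨ antidiagonalSum-shiftˡ N _ ⟩
    antidiagonalSum N (λ a b → f a (suc b))               ∎)
    where
    shift-suc : ∀ a b → a ℕ.+ b ≡ suc N → shiftˡ f a (suc b) ≈ shiftˡ (λ a b → f a (suc b)) a b
    shift-suc zero    b _ = refl
    shift-suc (suc a) b _ = refl

  antidiagonalSum-shiftʳ : ∀ N f → antidiagonalSum (suc N) (shiftʳ f) ≈ antidiagonalSum N f
  antidiagonalSum-shiftʳ N f = +-identityˡ _

  sumFrom≈antidiagonalSum : ∀ N u φ → sumFrom u (suc N) φ ≈ antidiagonalSum N (λ _ b → φ (u ℤ.+ + b))
  sumFrom≈antidiagonalSum zero    u φ = trans (+-identityʳ _) (reflexive (≡.cong φ (≡.sym (ℤP.+-identityʳ u))))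
  sumFrom≈antidiagonalSum (suc N) u φ = +-cong (reflexive (≡.cong φ (≡.sym (ℤP.+-identityʳ u)))) (begin
    sumFrom (ℤ.suc u) (suc N) φ
      ≈⟨ sumFrom≈antidiagonalSum N (ℤ.suc u) φ ⟩
    antidiagonalSum N (λ _ b → φ (ℤ.suc u ℤ.+ + b))
      ≈⟨ antidiagonalSum-cong N (λ _ b _ → reflexive (≡.cong φ ([1+i]+j≡i+[1+j] u (+ b)))) ⟩
    antidiagonalSum N (λ _ b → φ (u ℤ.+ + suc b)) ∎)

  1-xy≈y[1-x]+[1-y] : ∀ x y → 1# + - (x * y) ≈ y * (1# + - x) + (1# + - y)
  1-xy≈y[1-x]+[1-y] x y = begin
    1# + - (x * y)                  ≈⟨ +-congˡ (-‿cong (*-comm x y)) ⟩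
    1# + - (y * x)                  ≈⟨ +-identityˡ _ ⟨
    0# + (1# + - (y * x))           ≈⟨ +-congʳ (-‿inverseʳ y) ⟨
    (y + - y) + (1# + - (y * x))    ≈⟨ solve 4 (λ y o my myx → (y :+ my) :+ (o :+ myx) := (y :+ myx) :+ (o :+ my))
                                         refl y 1# (- y) (- (y * x)) ⟩
    (y + - (y * x)) + (1# + - y)    ≈⟨ +-congʳ (+-cong (*-identityʳ y) (sym (-‿distribʳ-* y x))) ⟨
    (y * 1# + y * - x) + (1# + - y) ≈⟨ +-congʳ (distribˡ y 1# (- x)) ⟨
    y * (1# + - x) + (1# + - y)     ∎

  module Gaussian (q : Carrier) where

    -- gaussian a b is the Gaussian binomial [a+b choose a]_q
    gaussian : ℕ → ℕ → Carrier
    gaussian a       zero    = 1#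
    gaussian zero    (suc b) = 1#
    gaussian (suc a) (suc b) = pow q (suc b) * gaussian a (suc b) + gaussian (suc a) b

    qpoch-+ : ∀ a b → qpoch q (a ℕ.+ b) ≈ gaussian a b * (qpoch q a * qpoch q b)
    qpoch-+ a zero = begin
      qpoch q (a ℕ.+ 0)          ≡⟨ ≡.cong (qpoch q) (ℕP.+-identityʳ a) ⟩
      qpoch q a                  ≈⟨ *-identityʳ _ ⟨
      qpoch q a * 1#             ≈⟨ *-identityˡ _ ⟨
      1# * (qpoch q a * 1#)      ∎
    qpoch-+ zero (suc b) = sym (trans (*-identityˡ _) (*-identityˡ _))
    qpoch-+ (suc a) (suc b) = begin
      Q * (1# + - pow q (suc a ℕ.+ suc b))
        ≈⟨ *-congˡ (+-congˡ (-‿cong (pow-homo-+ q (suc a) (suc b)))) ⟩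
      Q * (1# + - (u * v))
        ≈⟨ *-congˡ (1-xy≈y[1-x]+[1-y] u v) ⟩
      Q * (v * (1# + - u) + (1# + - v))
        ≈⟨ distribˡ Q _ _ ⟩
      Q * (v * (1# + - u)) + Q * (1# + - v)
        ≈⟨ +-cong (*-congʳ (qpoch-+ a (suc b)))
                  (*-congʳ (trans (reflexive (≡.cong (qpoch q) (ℕP.+-suc a b))) (qpoch-+ (suc a) b))) ⟩
      (X * (Pa * Pb′)) * (v * (1# + - u)) + (Y * (Pa′ * Pb)) * (1# + - v)
        ≈⟨ +-cong (solve 5 (λ X Pa Pb′ v w → (X :* (Pa :* Pb′)) :* (v :* w) := (v :* X) :* ((Pa :* w) :* Pb′))
                           refl X Pa Pb′ v (1# + - u))
                  (solve 4 (λ Y Pa′ Pb w → (Y :* (Pa′ :* Pb)) :* w := Y :* (Pa′ :* (Pb :* w)))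
                           refl Y Pa′ Pb (1# + - v)) ⟩
      (v * X) * (Pa′ * Pb′) + Y * (Pa′ * Pb′)
        ≈⟨ distribʳ _ _ _ ⟨
      gaussian (suc a) (suc b) * (Pa′ * Pb′) ∎
      where
      Q = qpoch q (a ℕ.+ suc b)
      u = pow q (suc a)
      v = pow q (suc b)
      X = gaussian a (suc b)
      Y = gaussian (suc a) b
      Pa = qpoch q a
      Pb = qpoch q b
      Pa′ = qpoch q (suc a)
      Pb′ = qpoch q (suc b)

    weight : Carrier → ℕ → Carrier
    weight z b = pow (- 1#) b * pow q (b C 2) * pow z b

    weight-suc : ∀ z b → weight z (suc b) ≈ - z * weight (q * z) b
    weight-suc z b = begin
      (- 1# * S) * pow q (suc b C 2) * (z * Z)
        ≡⟨ ≡.cong (λ e → (- 1# * S) * pow q e * (z * Z)) ([1+n]C2≡n+nC2 b) ⟩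
      (- 1# * S) * pow q (b ℕ.+ b C 2) * (z * Z)
        ≈⟨ *-congʳ (*-congˡ (pow-homo-+ q b (b C 2))) ⟩
      (- 1# * S) * (pow q b * T) * (z * Z)
        ≈⟨ solve 6 (λ m S Q T z Z → (m :* S) :* (Q :* T) :* (z :* Z) := m :* (z :* (S :* T :* (Q :* Z))))
                 refl (- 1#) S (pow q b) T z Z ⟩
      - 1# * (z * (S * T * (pow q b * Z)))
        ≈⟨ *-congˡ (*-congˡ (*-congˡ (pow-distrib-* q z b))) ⟨
      - 1# * (z * weight (q * z) b)
        ≈⟨ -1*x≈-x _ ⟩
      - (z * weight (q * z) b)
        ≈⟨ -‿distribˡ-* z _ ⟩
      - z * weight (q * z) b ∎
      where
      S = pow (- 1#) b
      T = pow q (b C 2)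
      Z = pow z b

    weight-*q^ : ∀ z b → weight z b * pow q b ≈ weight (q * z) b
    weight-*q^ z b = begin
      (S * T * pow z b) * pow q b   ≈⟨ solve 4 (λ S T Z Q → (S :* T :* Z) :* Q := S :* T :* (Q :* Z))
                                           refl S T (pow z b) (pow q b) ⟩
      S * T * (pow q b * pow z b)   ≈⟨ *-congˡ (pow-distrib-* q z b) ⟨
      weight (q * z) b              ∎
      where
      S = pow (- 1#) b
      T = pow q (b C 2)

    cauchySum : ℕ → Carrier → Carrier
    cauchySum N z = antidiagonalSum N (λ a b → weight z b * gaussian a b)

    cauchySum-suc : ∀ N z → cauchySum (suc N) z ≈ (1# + - z) * cauchySum N (q * z)
    cauchySum-suc N z = begin
      cauchySum (suc N) z
        ≈⟨ antidiagonalSum-cong (suc N) pascal ⟩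
      antidiagonalSum (suc N) (λ a b → shiftˡ X a b + - z * shiftʳ X a b)
        ≈⟨ antidiagonalSum-+ (suc N) (shiftˡ X) (λ a b → - z * shiftʳ X a b) ⟩
      antidiagonalSum (suc N) (shiftˡ X) + antidiagonalSum (suc N) (λ a b → - z * shiftʳ X a b)
        ≈⟨ +-congˡ (*-distribˡ-antidiagonalSum (suc N) (- z) (shiftʳ X)) ⟨
      antidiagonalSum (suc N) (shiftˡ X) + - z * antidiagonalSum (suc N) (shiftʳ X)
        ≈⟨ +-cong (antidiagonalSum-shiftˡ N X) (*-congˡ (antidiagonalSum-shiftʳ N X)) ⟩
      cauchySum N (q * z) + - z * cauchySum N (q * z)
        ≈⟨ +-congʳ (*-identityˡ _) ⟨
      1# * cauchySum N (q * z) + - z * cauchySum N (q * z)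
        ≈⟨ distribʳ _ 1# (- z) ⟨
      (1# + - z) * cauchySum N (q * z) ∎
      where
      X : ℕ → ℕ → Carrier
      X a b = weight (q * z) b * gaussian a b
      pascal : ∀ a b → a ℕ.+ b ≡ suc N → weight z b * gaussian a b ≈ shiftˡ X a b + - z * shiftʳ X a b
      pascal zero    (suc b) _ = begin
        weight z (suc b) * gaussian 0 (suc b)   ≈⟨ *-identityʳ _ ⟩
        weight z (suc b)                        ≈⟨ weight-suc z b ⟩
        - z * weight (q * z) b                  ≈⟨ *-congˡ (*-identityʳ _) ⟨
        - z * (weight (q * z) b * 1#)           ≈⟨ *-congˡ (*-congˡ (gaussian-0ˡ b)) ⟨
        - z * X 0 b                             ≈⟨ +-identityˡ _ ⟨
        0# + - z * X 0 b                        ∎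
        where
        gaussian-0ˡ : ∀ b → gaussian 0 b ≈ 1#
        gaussian-0ˡ zero    = refl
        gaussian-0ˡ (suc b) = refl
      pascal (suc a) zero    _ = sym (trans (+-congˡ (zeroʳ (- z))) (+-identityʳ _))
      pascal (suc a) (suc b) _ = begin
        weight z (suc b) * (pow q (suc b) * gaussian a (suc b) + gaussian (suc a) b)
          ≈⟨ distribˡ _ _ _ ⟩
        weight z (suc b) * (pow q (suc b) * gaussian a (suc b)) + weight z (suc b) * gaussian (suc a) b
          ≈⟨ +-cong (sym (*-assoc _ _ _)) (*-congʳ (weight-suc z b)) ⟩
        (weight z (suc b) * pow q (suc b)) * gaussian a (suc b) + (- z * weight (q * z) b) * gaussian (suc a) b
          ≈⟨ +-cong (*-congʳ (weight-*q^ z (suc b))) (*-assoc _ _ _) ⟩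
        X a (suc b) + - z * X (suc a) b ∎

    poch : Carrier → ℕ → Carrier
    poch z zero    = 1#
    poch z (suc N) = (1# + - z) * poch (q * z) N

    q-binomial : ∀ N z → cauchySum N z ≈ poch z N
    q-binomial zero    z = trans (*-identityʳ _) (trans (*-identityʳ _) (*-identityʳ _))
    q-binomial (suc N) z = trans (cauchySum-suc N z) (*-congˡ (q-binomial N (q * z)))

    poch-vanishes : ∀ N m z → z * pow q m ≈ 1# → m ℕ.< N → poch z N ≈ 0#
    poch-vanishes (suc N) zero    z z≈1 _ = begin
      (1# + - z) * poch (q * z) N   ≈⟨ *-congʳ (+-congˡ (-‿cong (trans (sym (*-identityʳ z)) z≈1))) ⟩
      (1# + - 1#) * poch (q * z) N  ≈⟨ *-congʳ (-‿inverseʳ 1#) ⟩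
      0# * poch (q * z) N           ≈⟨ zeroˡ _ ⟩
      0#                            ∎
    poch-vanishes (suc N) (suc m) z zq^m≈1 (ℕ.s≤s m<N) = begin
      (1# + - z) * poch (q * z) N   ≈⟨ *-congˡ (poch-vanishes N m (q * z) qzq^m≈1 m<N) ⟩
      (1# + - z) * 0#               ≈⟨ zeroʳ _ ⟩
      0#                            ∎
      where
      qzq^m≈1 : (q * z) * pow q m ≈ 1#
      qzq^m≈1 = trans (solve 3 (λ q z Q → (q :* z) :* Q := z :* (q :* Q)) refl q z (pow q m)) zq^m≈1

    module WithInverses (inv : ℕ → Carrier) (qpoch*inv≈1 : ∀ m → qpoch q m * inv m ≈ 1#) where

      qpoch*inv*inv≈gaussian : ∀ a b → qpoch q (a ℕ.+ b) * (inv a * inv b) ≈ gaussian a b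
      qpoch*inv*inv≈gaussian a b = begin
        qpoch q (a ℕ.+ b) * (inv a * inv b)
          ≈⟨ *-congʳ (qpoch-+ a b) ⟩
        (gaussian a b * (qpoch q a * qpoch q b)) * (inv a * inv b)
          ≈⟨ solve 5 (λ G Pa Pb ia ib → (G :* (Pa :* Pb)) :* (ia :* ib) := G :* ((Pa :* ia) :* (Pb :* ib)))
                   refl (gaussian a b) (qpoch q a) (qpoch q b) (inv a) (inv b) ⟩
        gaussian a b * ((qpoch q a * inv a) * (qpoch q b * inv b))
          ≈⟨ *-congˡ (trans (*-cong (qpoch*inv≈1 a) (qpoch*inv≈1 b)) (*-identityʳ 1#)) ⟩
        gaussian a b * 1#
          ≈⟨ *-identityʳ _ ⟩
        gaussian a b ∎

      inverseSum-vanishes : ∀ N m z → z * pow q m ≈ 1# → m ℕ.< N →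
        antidiagonalSum N (λ a b → weight z b * (inv a * inv b)) ≈ 0#
      inverseSum-vanishes N m z zq^m≈1 m<N = begin
        S                               ≈⟨ *-identityˡ S ⟨
        1# * S                          ≈⟨ *-congʳ (trans (*-comm _ _) (qpoch*inv≈1 N)) ⟨
        (inv N * qpoch q N) * S         ≈⟨ *-assoc _ _ _ ⟩
        inv N * (qpoch q N * S)         ≈⟨ *-congˡ (*-distribˡ-antidiagonalSum N (qpoch q N) _) ⟩
        inv N * antidiagonalSum N (λ a b → qpoch q N * (weight z b * (inv a * inv b)))
                                        ≈⟨ *-congˡ (antidiagonalSum-cong N weighted) ⟩
        inv N * cauchySum N z           ≈⟨ *-congˡ (q-binomial N z) ⟩
        inv N * poch z N                ≈⟨ *-congˡ (poch-vanishes N m z zq^m≈1 m<N) ⟩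
        inv N * 0#                      ≈⟨ zeroʳ _ ⟩
        0#                              ∎
        where
        S = antidiagonalSum N (λ a b → weight z b * (inv a * inv b))
        weighted : ∀ a b → a ℕ.+ b ≡ N →
                   qpoch q N * (weight z b * (inv a * inv b)) ≈ weight z b * gaussian a b
        weighted a b ≡.refl = trans (x∙yz≈y∙xz _ _ _) (*-congˡ (qpoch*inv*inv≈gaussian a b))

  module AlternatingSum (q qinv : Carrier) (q*qinv≈1 : q * qinv ≈ 1#)
                        (inv : ℕ → Carrier) (qpoch*inv≈1 : ∀ m → qpoch q m * inv m ≈ 1#) where
    open Gaussian q
    open WithInverses inv qpoch*inv≈1

    summand : ℤ → ℕ → ℕ → ℤ → Carrier
    summand s n M i = signZ i * zpow q qinv (halfExp s i) * inv ℤ.∣ + n ℤ.- i ∣ * inv ℤ.∣ + M ℤ.+ i ∣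

    summand-reindex : ∀ k m n a b → a ℕ.+ b ≡ n ℕ.+ (k ℕ.+ m) →
      summand (+ 2 ℤ.* + k ℤ.- + 1) n (k ℕ.+ m) (ℤ.- + (k ℕ.+ m) ℤ.+ + b)
        ≈ (pow (- 1#) (k ℕ.+ m) * pow q (suc (k ℕ.+ m) C 2) * pow qinv (k ℕ.* (k ℕ.+ m)))
          * (weight (pow qinv m) b * (inv a * inv b))
    summand-reindex k m n a b a+b≡n+M = begin
      summand (+ 2 ℤ.* + k ℤ.- + 1) n M i
        ≡⟨ ≡.cong₂ (λ e x → e * inv x * inv ℤ.∣ + M ℤ.+ i ∣)
             (≡.cong₂ (λ j e → signZ j * zpow q qinv e) (ℤP.-m+n≡n⊖m M b) (halfExp-odd-shift k m b))
             (∣n-[-M+b]∣≡a n M a b a+b≡n+M) ⟩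
      signZ (b ⊖ M) * zpow q qinv (P ⊖ Q) * inv a * inv ℤ.∣ + M ℤ.+ i ∣
        ≡⟨ ≡.cong (λ x → signZ (b ⊖ M) * zpow q qinv (P ⊖ Q) * inv a * inv x) (∣M+[-M+b]∣≡b M b) ⟩
      signZ (b ⊖ M) * zpow q qinv (P ⊖ Q) * inv a * inv b
        ≈⟨ *-congʳ (*-congʳ (*-cong (signZ-⊖ b M) (zpow-⊖ q*qinv≈1 P Q))) ⟩
      (sb * sM) * (pow q P * pow qinv Q) * inv a * inv b
        ≈⟨ *-congʳ (*-congʳ (*-congˡ (*-cong (pow-homo-+ q (b C 2) _)
             (trans (pow-homo-+ qinv (m ℕ.* b) _) (*-congʳ (sym (pow-assocʳ qinv m b))))))) ⟩
      (sb * sM) * ((Tb * TM) * (Zb * K)) * inv a * inv b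
        ≈⟨ solve 8 (λ sb sM Tb TM Zb K ia ib →
                      (sb :* sM) :* ((Tb :* TM) :* (Zb :* K)) :* ia :* ib
                        := (sM :* TM :* K) :* ((sb :* Tb :* Zb) :* (ia :* ib)))
                 refl sb sM Tb TM Zb K (inv a) (inv b) ⟩
      (sM * TM * K) * (weight (pow qinv m) b * (inv a * inv b)) ∎
      where
      M = k ℕ.+ m
      i = ℤ.- + M ℤ.+ + b
      P = b C 2 ℕ.+ suc M C 2
      Q = m ℕ.* b ℕ.+ k ℕ.* M
      sb = pow (- 1#) b
      sM = pow (- 1#) M
      Tb = pow q (b C 2)
      TM = pow q (suc M C 2)
      Zb = pow (pow qinv m) b
      K = pow qinv (k ℕ.* M)

    alternatingSum-vanishes : ∀ k M n → k ℕ.≤ M → 1 ℕ.≤ n →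
      sumFrom (ℤ.- + M) (suc (n ℕ.+ M)) (summand (+ 2 ℤ.* + k ℤ.- + 1) n M) ≈ 0#
    alternatingSum-vanishes k M n k≤M 1≤n with M ℕ.∸ k | ℕP.m+[n∸m]≡n k≤M
    ... | m | ≡.refl = begin
      sumFrom (ℤ.- + M) (suc N) (summand s n M)
        ≈⟨ sumFrom≈antidiagonalSum N (ℤ.- + M) (summand s n M) ⟩
      antidiagonalSum N (λ _ b → summand s n M (ℤ.- + M ℤ.+ + b))
        ≈⟨ antidiagonalSum-cong N (summand-reindex k m n) ⟩
      antidiagonalSum N (λ a b → factor * (weight z b * (inv a * inv b)))
        ≈⟨ *-distribˡ-antidiagonalSum N factor _ ⟨
      factor * antidiagonalSum N (λ a b → weight z b * (inv a * inv b))
        ≈⟨ *-congˡ (inverseSum-vanishes N m z zq^m≈1 m<N) ⟩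
      factor * 0#
        ≈⟨ zeroʳ factor ⟩
      0# ∎
      where
      s = + 2 ℤ.* + k ℤ.- + 1
      N = n ℕ.+ M
      z = pow qinv m
      factor = pow (- 1#) M * pow q (suc M C 2) * pow qinv (k ℕ.* M)
      zq^m≈1 : z * pow q m ≈ 1#
      zq^m≈1 = trans (*-comm _ _) (pow-inverse q*qinv≈1 m)
      m<N : m ℕ.< N
      m<N = ℕP.≤-<-trans (ℕP.m≤n+m m k) (ℕP.m<n+m M 1≤n)

lemma5p12 : ∀ {c ℓ} (R : CommutativeRing c ℓ) →
    let open CommutativeRing R
        open QSeries R
    in (t : ℕ) (s : ℤ) → (∃[ k ] s ≡ + 1 ℤ.+ + 2 ℤ.* k) →
       ℤ.- (+ 1) ℤ.≤ s → s ℤ.≤ + (2 ℕ.* t ℕ.+ 1) →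
       (n : ℕ) → 1 ℕ.≤ n →
       (q qinv : Carrier) → q * qinv ≈ 1# →
       (inv : ℕ → Carrier) → (∀ m → qpoch q m * inv m ≈ 1#) →
       sumFrom (ℤ.- (+ (n ℕ.+ t))) (2 ℕ.* n ℕ.+ t ℕ.+ 1)
         (λ i → signZ i * zpow q qinv (halfExp s i)
                  * inv ℤ.∣ + n ℤ.- i ∣ * inv ℤ.∣ + (n ℕ.+ t) ℤ.+ i ∣)
         ≈ 0#
lemma5p12 R t s (k , s≡1+2k) -1≤s s≤2t+1 n 1≤n q qinv q*qinv≈1 inv qpoch*inv≈1
  with odd≥-1⇒2j-1 t s k s≡1+2k -1≤s s≤2t+1
... | j , j≤1+t , ≡.refl =
  ≡.subst (λ L → sumFrom (ℤ.- + (n ℕ.+ t)) L (summand (+ 2 ℤ.* + j ℤ.- + 1) n (n ℕ.+ t)) ≈ 0#)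
          length
          (alternatingSum-vanishes j (n ℕ.+ t) n (ℕP.≤-trans j≤1+t (ℕP.+-monoˡ-≤ t 1≤n)) 1≤n)
  where
  open CommutativeRing R
  open QSeries R
  open QSeriesProperties R
  open AlternatingSum q qinv q*qinv≈1 inv qpoch*inv≈1
  length : suc (n ℕ.+ (n ℕ.+ t)) ≡ 2 ℕ.* n ℕ.+ t ℕ.+ 1
  length = ℕ-Solver.solve (n ∷ t ∷ [])
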